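{- Let $p$ be an odd prime. For $k=1,2,\ldots$ define $a_k(x)=\sum_{m=0}^{k}\left(\frac{k-m}{p}\right)x^m$, let $H_p(x)=\det\big[a_{i+j-1}(x)\big]_{1\le i,j\le p}$, and let $\mathbf{C}_p=\left[\left(\frac{i+j}{p}\right)\right]_{1\le i,j\le p-1}$. Then $$H_p(x)=\det\mathbf{C}_p\,\sum_{j=1}^{p} a_j(x).$$
   Context: For a prime $p$, the Legendre symbol $\left(\frac{a}{p}\right)$ is $0$ if $p\mid a$, $1$ if $a$ is a nonzero quadratic residue mod $p$, and $-1$ if $a$ is a quadratic nonresidue mod $p$. -}

module Defs where

open import Data.Nat using (ℕ; zero; suc; _%_; _≟_)
open import Data.Integer using (ℤ; +_; -[1+_])
open import Data.Fin using (Fin; toℕ; punchIn) renaming (zero to fzero; suc to fsuc)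
open import Data.Fin.Properties using (any?)
open import Data.Product using (∃)
open import Relation.Nullary using (yes; no)
open import Algebra.Bundles using (CommutativeRing)
import Data.Nat as N

-- Legendre symbol (a / p) for a prime p (value for p = 0 is irrelevant).
-- 0 if p ∣ a, 1 if a is a nonzero square mod p, -1 otherwise.
legendre : ℕ → ℕ → ℤ
legendre zero a = + 0
legendre (suc q) a with a % suc q ≟ 0
... | yes _ = + 0
... | no _ with any? (λ (x : Fin (suc q)) → (N._*_ (toℕ x) (toℕ x)) % suc q ≟ a % suc q)
...   | yes _ = + 1
...   | no _ = -[1+ 0 ]

module RingDefs {c ℓ} (R : CommutativeRing c ℓ) where
  open CommutativeRing R

  Σ : (n : ℕ) → (Fin n → Carrier) → Carrier
  Σ zero f = 0#
  Σ (suc n) f = f fzero + Σ n (λ i → f (fsuc i))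

  pow : Carrier → ℕ → Carrier
  pow x zero = 1#
  pow x (suc m) = x * pow x m

  fromℕ : ℕ → Carrier
  fromℕ zero = 0#
  fromℕ (suc n) = 1# + fromℕ n

  ι : ℤ → Carrier
  ι (+ n) = fromℕ n
  ι -[1+ n ] = - fromℕ (suc n)

  sgn : ℕ → Carrier
  sgn zero = 1#
  sgn (suc k) = - sgn k

  det : (n : ℕ) → (Fin n → Fin n → Carrier) → Carrier
  det zero M = 1#
  det (suc n) M =
    Σ (suc n) (λ j → sgn (toℕ j) * (M fzero j * det n (λ r s → M (fsuc r) (punchIn j s))))

  a : ℕ → ℕ → Carrier → Carrier
  a p k x = Σ (suc k) (λ m → ι (legendre p (N._∸_ k (toℕ m))) * pow x (toℕ m))

  -- H_p(x) = det [a_{i+j-1}(x)]_{1≤i,j≤p}  (0-indexed: a_{i+j+1})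
  H : ℕ → Carrier → Carrier
  H p x = det p (λ i j → a p (N._+_ (N._+_ (toℕ i) (toℕ j)) 1) x)

  -- det C_p, C_p = [((i+j)/p)]_{1≤i,j≤p-1}  (0-indexed: (i+j+2)/p)
  detC : ℕ → Carrier
  detC p = det (N._∸_ p 1) (λ i j → ι (legendre p (N._+_ (N._+_ (toℕ i) (toℕ j)) 2)))

module Submission where

-- Write χ(r) = (r/p). Since a_{m+1}(x) = χ(m+1) + x·a_m(x), subtracting x times each
-- column of the Hankel matrix [a_{i+j+1}(x)] from the next one (right to left) leaves the
-- matrix with first column a_{i+1}(x) and further entries χ(i+j+1). We transpose it and
-- replace every column by the sum of the columns up to it; neither step changes the
-- determinant. Below the first row, the last column now holds sums of χ over p consecutive
-- integers, which vanish because χ is p-periodic and there are as many quadratic residues as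
-- nonresidues. Expanding along the first row therefore leaves a single term:
-- sgn(p-1) · Σ_j a_j(x) · det of the partial-sum version of C_p, which equals det C_p.

open import Defs
open import Data.Nat as N using (ℕ; zero; suc)
import Data.Nat.Properties as NP
open import Data.Nat.Primality using (Prime; ¬prime[0])
open import Data.Fin as F using (Fin; toℕ; punchIn; punchOut) renaming (zero to fzero; suc to fsuc)
open import Data.Fin.Properties as FP using (punchIn-injective; punchInᵢ≢i; punchIn-punchOut)
import Data.Integer as ℤ
open import Data.Product using (_×_; _,_)
open import Data.Sum using (_⊎_; inj₁; inj₂; [_,_]′)
open import Data.Empty using (⊥-elim)
open import Function using (_∘_)
open import Relation.Nullary using (¬_; yes; no)
open import Relation.Binary.PropositionalEquality as Eq using (_≡_; _≢_; refl; cong)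
open import Algebra.Bundles using (CommutativeRing)
import Algebra.Solver.CommutativeMonoid as CommutativeMonoidSolver

module NatSum where
  open import Data.Nat
  open import Data.Nat.Properties
  open import Data.Bool using (true; false; if_then_else_; T)
  open import Data.Unit using (tt)
  open import Data.Nat.Tactic.RingSolver using (solve-∀)
  open Eq using (sym; trans; subst; cong₂)

  sumℕ : ℕ → (ℕ → ℕ) → ℕ
  sumℕ zero f = 0
  sumℕ (suc n) f = f 0 + sumℕ n (λ r → f (suc r))

  sumℕ-cong : ∀ n {f g : ℕ → ℕ} → (∀ r → r < n → f r ≡ g r) → sumℕ n f ≡ sumℕ n g
  sumℕ-cong zero eq = refl
  sumℕ-cong (suc n) eq = cong₂ _+_ (eq 0 z<s) (sumℕ-cong n (λ r r<n → eq (suc r) (s<s r<n)))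

  sumℕ-+ : ∀ n (f g : ℕ → ℕ) → sumℕ n (λ r → f r + g r) ≡ sumℕ n f + sumℕ n g
  sumℕ-+ zero f g = refl
  sumℕ-+ (suc n) f g = trans (cong ((f 0 + g 0) +_) (sumℕ-+ n (λ r → f (suc r)) (λ r → g (suc r))))
                             (interchange (f 0) (g 0) _ _)
    where
    interchange : ∀ a b c d → (a + b) + (c + d) ≡ (a + c) + (b + d)
    interchange = solve-∀

  sumℕ-0 : ∀ n → sumℕ n (λ _ → 0) ≡ 0
  sumℕ-0 zero = refl
  sumℕ-0 (suc n) = sumℕ-0 n

  sumℕ-zero : ∀ n {f : ℕ → ℕ} → (∀ r → r < n → f r ≡ 0) → sumℕ n f ≡ 0
  sumℕ-zero n f≡0 = trans (sumℕ-cong n f≡0) (sumℕ-0 n)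

  sumℕ-1 : ∀ n → sumℕ n (λ _ → 1) ≡ n
  sumℕ-1 zero = refl
  sumℕ-1 (suc n) = cong suc (sumℕ-1 n)

  sumℕ-comm : ∀ m n (f : ℕ → ℕ → ℕ) →
              sumℕ m (λ i → sumℕ n (f i)) ≡ sumℕ n (λ j → sumℕ m (λ i → f i j))
  sumℕ-comm zero n f = sym (sumℕ-0 n)
  sumℕ-comm (suc m) n f = trans (cong (sumℕ n (f 0) +_) (sumℕ-comm m n (λ i → f (suc i))))
                                (sym (sumℕ-+ n (f 0) _))

  δ : ℕ → ℕ → ℕ
  δ v r = if v ≡ᵇ r then 1 else 0

  δ-refl : ∀ v → δ v v ≡ 1
  δ-refl v with v ≡ᵇ v in e
  ... | true = refl
  ... | false = ⊥-elim (subst T e (≡⇒≡ᵇ v v refl))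

  δ-≢ : ∀ {v r} → v ≢ r → δ v r ≡ 0
  δ-≢ {v} {r} v≢r with v ≡ᵇ r in e
  ... | false = refl
  ... | true = ⊥-elim (v≢r (≡ᵇ⇒≡ v r (subst T (sym e) tt)))

  sumℕ-δ : ∀ n v → v < n → sumℕ n (δ v) ≡ 1
  sumℕ-δ (suc n) zero _ = cong suc (sumℕ-0 n)
  sumℕ-δ (suc n) (suc v) (s<s v<n) = sumℕ-δ n v v<n

module Residues (q : ℕ) where
  open import Data.Nat
  open import Data.Nat.Properties
  open import Data.Nat.DivMod
  open import Data.Nat.Divisibility
  open import Data.Nat.Primality using (euclidsLemma; composite-≢)
  open import Data.Fin.Properties using (any?; toℕ<n; toℕ-fromℕ<)
  open import Data.Nat.Tactic.RingSolver using (solve-∀)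
  open NatSum
  open Eq using (sym; trans; cong₂)
  open Eq.≡-Reasoning

  P : ℕ
  P = suc q

  -- The three clauses of the definition of legendre P r, together with their evidence.
  data Symbol (r : ℕ) : ℤ.ℤ → Set where
    divisible  : r % P ≡ 0 → Symbol r (ℤ.+ 0)
    residue    : r % P ≢ 0 → (a : Fin P) → toℕ a * toℕ a % P ≡ r % P → Symbol r (ℤ.+ 1)
    nonresidue : r % P ≢ 0 → (∀ (a : Fin P) → toℕ a * toℕ a % P ≢ r % P) → Symbol r ℤ.-[1+ 0 ]

  symbol : ∀ r → Symbol r (legendre P r)
  symbol r with r % P ≟ 0
  ... | yes r≡0 = divisible r≡0
  ... | no r≢0 with any? (λ (a : Fin P) → toℕ a * toℕ a % P ≟ r % P)
  ...   | yes (a , a²≡r) = residue r≢0 a a²≡r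
  ...   | no no-root = nonresidue r≢0 (λ a a²≡r → no-root (a , a²≡r))

  legendre-mod : ∀ {a b} → a % P ≡ b % P → legendre P a ≡ legendre P b
  legendre-mod {a} {b} a≡b with legendre P a | symbol a | legendre P b | symbol b
  ... | _ | divisible _        | _ | divisible _        = refl
  ... | _ | residue _ _ _      | _ | residue _ _ _      = refl
  ... | _ | nonresidue _ _     | _ | nonresidue _ _     = refl
  ... | _ | divisible a≡0      | _ | residue b≢0 _ _    = ⊥-elim (b≢0 (trans (sym a≡b) a≡0))
  ... | _ | divisible a≡0      | _ | nonresidue b≢0 _   = ⊥-elim (b≢0 (trans (sym a≡b) a≡0))
  ... | _ | residue a≢0 _ _    | _ | divisible b≡0      = ⊥-elim (a≢0 (trans a≡b b≡0))
  ... | _ | nonresidue a≢0 _   | _ | divisible b≡0      = ⊥-elim (a≢0 (trans a≡b b≡0))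
  ... | _ | residue _ x x²≡a   | _ | nonresidue _ none  = ⊥-elim (none x (trans x²≡a a≡b))
  ... | _ | nonresidue _ none  | _ | residue _ x x²≡b   = ⊥-elim (none x (trans x²≡b (sym a≡b)))

  legendre-periodic : ∀ r → legendre P (r + P) ≡ legendre P r
  legendre-periodic r = legendre-mod {r + P} {r} ([m+n]%n≡m%n r P)

  isOne isMinusOne : ℤ.ℤ → ℕ
  isOne (ℤ.+ 1) = 1
  isOne _ = 0
  isMinusOne ℤ.-[1+ 0 ] = 1
  isMinusOne _ = 0

  QR NR : ℕ → ℕ
  QR r = isOne (legendre P r)
  NR r = isMinusOne (legendre P r)

  nonzero : ℕ → ℕ
  nonzero zero = 0
  nonzero (suc _) = 1

  nonzero-≢0 : ∀ {r} → r % P ≢ 0 → nonzero r ≡ 1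
  nonzero-≢0 {zero} 0≢0 = ⊥-elim (0≢0 refl)
  nonzero-≢0 {suc r} _ = refl

  QR+NR : ∀ r → r < P → QR r + NR r ≡ nonzero r
  QR+NR r r<P with legendre P r | symbol r
  ... | _ | divisible r%P≡0 = cong nonzero (sym (trans (sym (m<n⇒m%n≡m r<P)) r%P≡0))
  ... | _ | residue r≢0 _ _ = sym (nonzero-≢0 r≢0)
  ... | _ | nonresidue r≢0 _ = sym (nonzero-≢0 r≢0)

  -- Counting the square roots of the residue classes shows that exactly half of the
  -- nonzero classes are quadratic residues.
  module Counting (isPrime : Prime P) (P≢2 : P ≢ 2) where

    ∣-below : ∀ {d} → P ∣ d → d < P → d ≡ 0
    ∣-below {zero} _ _ = refl
    ∣-below {suc d} P∣d d<P = ⊥-elim (<⇒≱ d<P (∣⇒≤ P∣d))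

    ∣-between : ∀ {m} → P ∣ m → 0 < m → m < P + P → m ≡ P
    ∣-between (divides zero m≡0) 0<m _ = ⊥-elim (<⇒≢ 0<m (sym m≡0))
    ∣-between (divides (suc zero) m≡P) _ _ = trans m≡P (+-identityʳ P)
    ∣-between (divides (suc (suc k)) m≡kP) _ m<2P =
      ⊥-elim (<⇒≱ m<2P (Eq.subst (P + P ≤_) (sym m≡kP) (+-monoʳ-≤ P (m≤m+n P (k * P)))))

    mod-diff : ∀ m k → (m + k) % P ≡ m % P → P ∣ k
    mod-diff m k eq = ∣m+n∣m⇒∣n (divides ((m + k) / P) (+-cancelˡ-≡ (m % P) _ _ (begin
        m % P + (m / P * P + k)   ≡⟨ sym (+-assoc (m % P) _ k) ⟩
        (m % P + m / P * P) + k   ≡⟨ cong (_+ k) (sym (m≡m%n+[m/n]*n m P)) ⟩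
        m + k                     ≡⟨ m≡m%n+[m/n]*n (m + k) P ⟩
        (m + k) % P + (m + k) / P * P ≡⟨ cong (_+ (m + k) / P * P) eq ⟩
        m % P + (m + k) / P * P   ∎)))
      (n∣m*n (m / P))

    odd : ∀ a → a + a ≢ P
    odd a a+a≡P = Prime.notComposite isPrime
      (composite-≢ 2 (λ 2≡P → P≢2 (sym 2≡P)) (divides a (trans (sym a+a≡P) (a+a≡a*2 a))))
      where
      a+a≡a*2 : ∀ a → a + a ≡ a * 2
      a+a≡a*2 = solve-∀

    square-nonzero : ∀ x → 0 < x → x < P → x * x % P ≢ 0
    square-nonzero x 0<x x<P x²≡0 with euclidsLemma x x isPrime (m%n≡0⇒n∣m _ _ x²≡0)
    ... | inj₁ P∣x = <⇒≱ x<P (∣⇒≤ ⦃ >-nonZero 0<x ⦄ P∣x)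
    ... | inj₂ P∣x = <⇒≱ x<P (∣⇒≤ ⦃ >-nonZero 0<x ⦄ P∣x)

    square-neg : ∀ a → a ≤ P → a * a % P ≡ (P ∸ a) * (P ∸ a) % P
    square-neg a a≤P = begin
      a * a % P                   ≡⟨ sym ([m+kn]%n≡m%n (a * a) b P) ⟩
      (a * a + b * P) % P         ≡⟨ cong (λ t → (a * a + b * t) % P) (sym a+b≡P) ⟩
      (a * a + b * (a + b)) % P   ≡⟨ cong (_% P) (expand a b) ⟩
      (b * b + a * (a + b)) % P   ≡⟨ cong (λ t → (b * b + a * t) % P) a+b≡P ⟩
      (b * b + a * P) % P         ≡⟨ [m+kn]%n≡m%n (b * b) a P ⟩
      b * b % P                   ∎
      where
      b = P ∸ a
      a+b≡P : a + b ≡ P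
      a+b≡P = m+[n∸m]≡n a≤P
      expand : ∀ a b → a * a + b * (a + b) ≡ b * b + a * (a + b)
      expand = solve-∀

    -- If x² ≡ a² (mod P) with a ≤ x, then P divides (x - a)(x + a), so x = a or x + a = P.
    square-roots-≤ : ∀ x a → a ≤ x → x < P → 0 < x → x * x % P ≡ a * a % P → x ≡ a ⊎ x + a ≡ P
    square-roots-≤ x a a≤x x<P 0<x x²≡a² with euclidsLemma (x ∸ a) (x + a) isPrime P∣[x-a][x+a]
      where
      a+d≡x : a + (x ∸ a) ≡ x
      a+d≡x = m+[n∸m]≡n a≤x
      expand : ∀ a d → (a + d) * (a + d) ≡ a * a + d * ((a + d) + a)
      expand = solve-∀
      x²≡a²+[x-a][x+a] : x * x ≡ a * a + (x ∸ a) * (x + a)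
      x²≡a²+[x-a][x+a] = begin
        x * x                                   ≡⟨ cong (λ t → t * t) (sym a+d≡x) ⟩
        (a + (x ∸ a)) * (a + (x ∸ a))           ≡⟨ expand a (x ∸ a) ⟩
        a * a + (x ∸ a) * ((a + (x ∸ a)) + a)   ≡⟨ cong (λ t → a * a + (x ∸ a) * (t + a)) a+d≡x ⟩
        a * a + (x ∸ a) * (x + a)               ∎
      P∣[x-a][x+a] : P ∣ (x ∸ a) * (x + a)
      P∣[x-a][x+a] = mod-diff (a * a) _ (trans (cong (_% P) (sym x²≡a²+[x-a][x+a])) x²≡a²)
    ... | inj₁ P∣x-a = inj₁ (begin
      x               ≡⟨ sym (m+[n∸m]≡n a≤x) ⟩
      a + (x ∸ a)     ≡⟨ cong (a +_) (∣-below P∣x-a (≤-<-trans (m∸n≤m x a) x<P)) ⟩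
      a + 0           ≡⟨ +-identityʳ a ⟩
      a               ∎)
    ... | inj₂ P∣x+a = inj₂ (∣-between P∣x+a (<-≤-trans 0<x (m≤m+n x a))
                                          (+-mono-< x<P (≤-<-trans a≤x x<P)))

    square-roots : ∀ x a → x < P → a < P → 0 < x → x * x % P ≡ a * a % P → x ≡ a ⊎ x + a ≡ P
    square-roots x a x<P a<P 0<x x²≡a² with ≤-total a x
    ... | inj₁ a≤x = square-roots-≤ x a a≤x x<P 0<x x²≡a²
    ... | inj₂ x≤a with square-roots-≤ a x x≤a a<P (<-≤-trans 0<x x≤a) (sym x²≡a²)
    ...   | inj₁ a≡x = inj₁ (sym a≡x)
    ...   | inj₂ a+x≡P = inj₂ (trans (+-comm x a) a+x≡P)

    root : ℕ → ℕ → ℕ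
    root zero r = 0
    root (suc x) r = δ (suc x * suc x % P) r

    root-at : ∀ {x r} → x ≢ 0 → x * x % P ≡ r → root x r ≡ 1
    root-at {zero} x≢0 _ = ⊥-elim (x≢0 refl)
    root-at {suc x} {r} _ x²≡r = trans (cong (λ t → δ t r) x²≡r) (δ-refl r)

    roots-of-x : ∀ x → sumℕ P (root x) ≡ nonzero x
    roots-of-x zero = sumℕ-0 P
    roots-of-x (suc x) = sumℕ-δ P _ (m%n<n (suc x * suc x) P)

    roots-of-residue : ∀ r (a : Fin P) → r < P → r % P ≢ 0 → toℕ a * toℕ a % P ≡ r % P →
                       sumℕ P (λ x → root x r) ≡ 2
    roots-of-residue r a r<P r≢0 a²≡r' = begin
      sumℕ P (λ x → root x r)                      ≡⟨ sumℕ-cong P root≡δ+δ ⟩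
      sumℕ P (λ x → δ a′ x + δ b x)                ≡⟨ sumℕ-+ P (δ a′) (δ b) ⟩
      sumℕ P (δ a′) + sumℕ P (δ b)                 ≡⟨ cong₂ _+_ (sumℕ-δ P a′ a<P) (sumℕ-δ P b b<P) ⟩
      2                                            ∎
      where
      a′ b : ℕ
      a′ = toℕ a
      b = P ∸ a′
      a<P : a′ < P
      a<P = toℕ<n a
      a²≡r : a′ * a′ % P ≡ r
      a²≡r = trans a²≡r' (m<n⇒m%n≡m r<P)
      a≢0 : a′ ≢ 0
      a≢0 a≡0 = r≢0 (trans (m<n⇒m%n≡m r<P) (trans (sym a²≡r) (cong (λ t → t * t % P) a≡0)))
      b<P : b < P
      b<P = ∸-monoʳ-< (n≢0⇒n>0 a≢0) (<⇒≤ a<P)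
      b≢0 : b ≢ 0
      b≢0 b≡0 = <⇒≱ a<P (m∸n≡0⇒m≤n b≡0)
      a≢b : a′ ≢ b
      a≢b a≡b = odd a′ (trans (cong (a′ +_) a≡b) (m+[n∸m]≡n (<⇒≤ a<P)))
      b²≡r : b * b % P ≡ r
      b²≡r = trans (sym (square-neg a′ (<⇒≤ a<P))) a²≡r
      other-root : ∀ x → x < P → x ≢ a′ → x ≢ b → root x r ≡ 0
      other-root zero _ _ _ = refl
      other-root (suc x) x<P x≢a x≢b = δ-≢ λ x²≡r →
        [ x≢a , (λ x+a≡P → x≢b (trans (sym (m+n∸n≡m (suc x) a′)) (cong (_∸ a′) x+a≡P))) ]′
          (square-roots (suc x) a′ x<P a<P z<s (trans x²≡r (sym a²≡r)))
      root≡δ+δ : ∀ x → x < P → root x r ≡ δ a′ x + δ b x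
      root≡δ+δ x x<P with x ≟ a′ | x ≟ b
      ... | yes refl | _ = trans (root-at a≢0 a²≡r) (cong₂ _+_ (sym (δ-refl x)) (sym (δ-≢ (a≢b ∘ sym))))
      ... | no x≢a | yes refl = trans (root-at b≢0 b²≡r) (cong₂ _+_ (sym (δ-≢ a≢b)) (sym (δ-refl x)))
      ... | no x≢a | no x≢b = trans (other-root x x<P x≢a x≢b) (cong₂ _+_ (sym (δ-≢ (x≢a ∘ sym))) (sym (δ-≢ (x≢b ∘ sym))))

    roots-of-r : ∀ r → r < P → sumℕ P (λ x → root x r) ≡ QR r + QR r
    roots-of-r r r<P with legendre P r | symbol r
    ... | _ | residue r≢0 a a²≡r = roots-of-residue r a r<P r≢0 a²≡r
    ... | _ | divisible r%P≡0 = sumℕ-zero P no-root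
      where
      no-root : ∀ x → x < P → root x r ≡ 0
      no-root zero _ = refl
      no-root (suc x) x<P = δ-≢ λ x²≡r → square-nonzero (suc x) z<s x<P
        (trans x²≡r (trans (sym (m<n⇒m%n≡m r<P)) r%P≡0))
    ... | _ | nonresidue _ none = sumℕ-zero P no-root
      where
      no-root : ∀ x → x < P → root x r ≡ 0
      no-root zero _ = refl
      no-root (suc x) x<P = δ-≢ λ x²≡r → none (F.fromℕ< x<P)
        (trans (cong (λ t → t * t % P) (toℕ-fromℕ< x<P)) (trans x²≡r (sym (m<n⇒m%n≡m r<P))))

    -- Double counting the pairs (x, r) with x² ≡ r: twice the number of residues is P - 1.
    twice-residues : sumℕ P QR + sumℕ P QR ≡ q
    twice-residues = begin
      sumℕ P QR + sumℕ P QR                           ≡⟨ sym (sumℕ-+ P QR QR) ⟩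
      sumℕ P (λ r → QR r + QR r)                      ≡⟨ sumℕ-cong P (λ r r<P → sym (roots-of-r r r<P)) ⟩
      sumℕ P (λ r → sumℕ P (λ x → root x r))          ≡⟨ sumℕ-comm P P (λ r x → root x r) ⟩
      sumℕ P (λ x → sumℕ P (root x))                  ≡⟨ sumℕ-cong P (λ x _ → roots-of-x x) ⟩
      sumℕ P nonzero                                  ≡⟨ sumℕ-1 q ⟩
      q                                               ∎

    nonresidues≡residues : sumℕ P NR ≡ sumℕ P QR
    nonresidues≡residues = +-cancelˡ-≡ (sumℕ P QR) _ _ (begin
      sumℕ P QR + sumℕ P NR           ≡⟨ sym (sumℕ-+ P QR NR) ⟩
      sumℕ P (λ r → QR r + NR r)      ≡⟨ sumℕ-cong P QR+NR ⟩
      sumℕ P nonzero                  ≡⟨ sumℕ-1 q ⟩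
      q                               ≡⟨ sym twice-residues ⟩
      sumℕ P QR + sumℕ P QR           ∎)

module Determinants {c ℓ} (R : CommutativeRing c ℓ) where
  open CommutativeRing R renaming (refl to ≈-refl; sym to ≈-sym; trans to ≈-trans)
  open RingDefs R
  open NatSum using (sumℕ)
  open import Relation.Binary.Reasoning.Setoid setoid
  open import Algebra.Properties.Ring ring using (-‿distribˡ-*; -‿involutive; -‿+-comm; -0#≈0#; +-cancelˡ; x+x≈x⇒x≈0)
  open CommutativeMonoidSolver +-commutativeMonoid using (_⊕_; _⊜_) renaming (solve to +-solve)
  open CommutativeMonoidSolver *-commutativeMonoid using () renaming (solve to *-solve; _⊕_ to _⊛_; _⊜_ to _⊜*_)

  Mat : ℕ → Set c
  Mat n = Fin n → Fin n → Carrier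

  ≡⇒≈ : ∀ {a b : Carrier} → a ≡ b → a ≈ b
  ≡⇒≈ refl = ≈-refl

  *-lcomm : ∀ a b d → a * (b * d) ≈ b * (a * d)
  *-lcomm = *-solve 3 (λ a b d → a ⊛ (b ⊛ d) ⊜* b ⊛ (a ⊛ d)) ≈-refl

  Σ-cong : ∀ n {f g : Fin n → Carrier} → (∀ i → f i ≈ g i) → Σ n f ≈ Σ n g
  Σ-cong zero f≈g = ≈-refl
  Σ-cong (suc n) f≈g = +-cong (f≈g fzero) (Σ-cong n (λ i → f≈g (fsuc i)))

  Σ-+ : ∀ n (f g : Fin n → Carrier) → Σ n (λ i → f i + g i) ≈ Σ n f + Σ n g
  Σ-+ zero f g = ≈-sym (+-identityʳ 0#)
  Σ-+ (suc n) f g = begin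
    (f fzero + g fzero) + Σ n (λ i → f (fsuc i) + g (fsuc i))
      ≈⟨ +-congˡ (Σ-+ n (λ i → f (fsuc i)) (λ i → g (fsuc i))) ⟩
    (f fzero + g fzero) + (Σ n (λ i → f (fsuc i)) + Σ n (λ i → g (fsuc i)))
      ≈⟨ +-solve 4 (λ a b c d → (a ⊕ b) ⊕ (c ⊕ d) ⊜ (a ⊕ c) ⊕ (b ⊕ d)) ≈-refl _ _ _ _ ⟩
    Σ (suc n) f + Σ (suc n) g ∎

  Σ-*ˡ : ∀ n a (f : Fin n → Carrier) → a * Σ n f ≈ Σ n (λ i → a * f i)
  Σ-*ˡ zero a f = zeroʳ a
  Σ-*ˡ (suc n) a f = ≈-trans (distribˡ a _ _) (+-congˡ (Σ-*ˡ n a (λ i → f (fsuc i))))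

  Σ-zero : ∀ n {f : Fin n → Carrier} → (∀ i → f i ≈ 0#) → Σ n f ≈ 0#
  Σ-zero zero f≈0 = ≈-refl
  Σ-zero (suc n) f≈0 = ≈-trans (+-cong (f≈0 fzero) (Σ-zero n (λ i → f≈0 (fsuc i)))) (+-identityʳ 0#)

  Σ-comm : ∀ m n (f : Fin m → Fin n → Carrier) →
           Σ m (λ i → Σ n (λ j → f i j)) ≈ Σ n (λ j → Σ m (λ i → f i j))
  Σ-comm zero n f = ≈-sym (Σ-zero n (λ _ → ≈-refl))
  Σ-comm (suc m) n f = begin
    Σ n (f fzero) + Σ m (λ i → Σ n (λ j → f (fsuc i) j)) ≈⟨ +-congˡ (Σ-comm m n (λ i → f (fsuc i))) ⟩
    Σ n (f fzero) + Σ n (λ j → Σ m (λ i → f (fsuc i) j)) ≈⟨ Σ-+ n _ _ ⟨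
    Σ n (λ j → Σ (suc m) (λ i → f i j))                   ∎

  Σ-single : ∀ n (f : Fin n → Carrier) (l : Fin n) → (∀ k → k ≢ l → f k ≈ 0#) → Σ n f ≈ f l
  Σ-single (suc n) f fzero f≈0 =
    ≈-trans (+-congˡ (Σ-zero n (λ i → f≈0 (fsuc i) (λ ())))) (+-identityʳ _)
  Σ-single (suc n) f (fsuc l) f≈0 = begin
    f fzero + Σ n (λ i → f (fsuc i)) ≈⟨ +-congʳ (f≈0 fzero (λ ())) ⟩
    0# + Σ n (λ i → f (fsuc i))      ≈⟨ +-identityˡ _ ⟩
    Σ n (λ i → f (fsuc i))           ≈⟨ Σ-single n _ l (λ k k≢l → f≈0 (fsuc k) (k≢l ∘ FP.suc-injective)) ⟩
    f (fsuc l)                       ∎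

  Σ-adjacent-pair : ∀ n (f : Fin n → Carrier) {c d : Fin n} → toℕ d ≡ suc (toℕ c) →
                    f c + f d ≈ 0# → (∀ j → j ≢ c → j ≢ d → f j ≈ 0#) → Σ n f ≈ 0#
  Σ-adjacent-pair (suc (suc n)) f {fzero} {fsuc fzero} refl pair rest = begin
    f fzero + (f (fsuc fzero) + Σ n (λ i → f (fsuc (fsuc i))))
      ≈⟨ +-assoc _ _ _ ⟨
    (f fzero + f (fsuc fzero)) + Σ n (λ i → f (fsuc (fsuc i)))
      ≈⟨ +-cong pair (Σ-zero n (λ i → rest (fsuc (fsuc i)) (λ ()) (λ ()))) ⟩
    0# + 0# ≈⟨ +-identityʳ 0# ⟩
    0# ∎
  Σ-adjacent-pair (suc n) f {fzero} {fsuc (fsuc _)} ()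
  Σ-adjacent-pair (suc n) f {fsuc c} {fzero} ()
  Σ-adjacent-pair (suc n) f {fsuc c} {fsuc d} d≡c+1 pair rest = begin
    f fzero + Σ n (λ i → f (fsuc i))
      ≈⟨ +-cong (rest fzero (λ ()) (λ ()))
                (Σ-adjacent-pair n (λ i → f (fsuc i)) (NP.suc-injective d≡c+1) pair
                   (λ j j≢c j≢d → rest (fsuc j) (j≢c ∘ FP.suc-injective) (j≢d ∘ FP.suc-injective))) ⟩
    0# + 0# ≈⟨ +-identityʳ 0# ⟩
    0# ∎

  Σ< : ℕ → (ℕ → Carrier) → Carrier
  Σ< n s = Σ n (λ k → s (toℕ k))

  Σ<-last : ∀ n s → Σ< (suc n) s ≈ Σ< n s + s n
  Σ<-last zero s = ≈-trans (+-identityʳ _) (≈-sym (+-identityˡ _))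
  Σ<-last (suc n) s = ≈-trans (+-congˡ (Σ<-last n (λ r → s (suc r)))) (≈-sym (+-assoc _ _ _))

  Σ<-rotate : ∀ n s → s n ≈ s 0 → Σ< n (λ r → s (suc r)) ≈ Σ< n s
  Σ<-rotate n s sₙ≈s₀ = +-cancelˡ (s 0) _ _ (begin
    Σ< (suc n) s      ≈⟨ Σ<-last n s ⟩
    Σ< n s + s n      ≈⟨ +-congˡ sₙ≈s₀ ⟩
    Σ< n s + s 0      ≈⟨ +-comm _ _ ⟩
    s 0 + Σ< n s      ∎)

  Σ<-periodic : ∀ n s → (∀ r → s (r N.+ n) ≈ s r) → ∀ m → Σ< n (λ k → s (k N.+ m)) ≈ Σ< n s
  Σ<-periodic n s periodic zero = Σ-cong n (λ k → ≡⇒≈ (cong s (NP.+-identityʳ (toℕ k))))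
  Σ<-periodic n s periodic (suc m) = begin
    Σ< n (λ k → s (k N.+ suc m))     ≈⟨ Σ-cong n (λ k → ≡⇒≈ (cong s (NP.+-suc (toℕ k) m))) ⟩
    Σ< n (λ k → s (suc k N.+ m))     ≈⟨ Σ<-rotate n (λ k → s (k N.+ m))
                                          (≈-trans (≡⇒≈ (cong s (NP.+-comm n m))) (periodic m)) ⟩
    Σ< n (λ k → s (k N.+ m))         ≈⟨ Σ<-periodic n s periodic m ⟩
    Σ< n s                           ∎

  fromℕ-+ : ∀ m n → fromℕ (m N.+ n) ≈ fromℕ m + fromℕ n
  fromℕ-+ zero n = ≈-sym (+-identityˡ _)
  fromℕ-+ (suc m) n = ≈-trans (+-congˡ (fromℕ-+ m n)) (≈-sym (+-assoc _ _ _))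

  Σ<-fromℕ : ∀ n (f : ℕ → ℕ) → Σ< n (λ r → fromℕ (f r)) ≈ fromℕ (sumℕ n f)
  Σ<-fromℕ zero f = ≈-refl
  Σ<-fromℕ (suc n) f = ≈-trans (+-congˡ (Σ<-fromℕ n (λ r → f (suc r)))) (≈-sym (fromℕ-+ (f 0) _))

  Σ-neg : ∀ n (f : Fin n → Carrier) → Σ n (λ i → - f i) ≈ - Σ n f
  Σ-neg zero f = ≈-sym -0#≈0#
  Σ-neg (suc n) f = ≈-trans (+-congˡ (Σ-neg n (λ i → f (fsuc i)))) (-‿+-comm _ _)

  sgn-double : ∀ h → sgn (h N.+ h) ≈ 1#
  sgn-double zero = ≈-refl
  sgn-double (suc h) = begin
    sgn (suc h N.+ suc h)   ≡⟨ cong (λ k → sgn (suc k)) (NP.+-suc h h) ⟩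
    - - sgn (h N.+ h)       ≈⟨ -‿involutive _ ⟩
    sgn (h N.+ h)           ≈⟨ sgn-double h ⟩
    1#                      ∎

  minor : ∀ {n} → Mat (suc n) → Fin (suc n) → Mat n
  minor M j r s = M (fsuc r) (punchIn j s)

  term : ∀ {n} → Mat (suc n) → Fin (suc n) → Carrier
  term {n} M j = sgn (toℕ j) * (M fzero j * det n (minor M j))

  det-cong : ∀ n {M N : Mat n} → (∀ i j → M i j ≈ N i j) → det n M ≈ det n N
  det-cong zero M≈N = ≈-refl
  det-cong (suc n) M≈N =
    Σ-cong (suc n) (λ j → *-congˡ {sgn (toℕ j)} (*-cong (M≈N fzero j) (det-cong n (λ r s → M≈N (fsuc r) (punchIn j s)))))

  -- s · (y + t·z) = s·y + t·(s·z): the shape of every step in the proof of linearity.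
  scale-combination : ∀ s y z t → s * (y + t * z) ≈ s * y + t * (s * z)
  scale-combination s y z t = ≈-trans (distribˡ s y (t * z)) (+-congˡ (*-lcomm s t z))

  det-linear : ∀ n (k : Fin n) (A B N : Mat n) (t : Carrier) →
               (∀ i j → j ≢ k → N i j ≈ A i j) → (∀ i j → j ≢ k → B i j ≈ A i j) →
               (∀ i → N i k ≈ A i k + t * B i k) → det n N ≈ det n A + t * det n B
  det-linear (suc n) k A B N t N≈A B≈A Nₖ = begin
    Σ (suc n) (term N)                               ≈⟨ Σ-cong (suc n) term-linear ⟩
    Σ (suc n) (λ j → term A j + t * term B j)        ≈⟨ Σ-+ (suc n) (term A) (λ j → t * term B j) ⟩
    det (suc n) A + Σ (suc n) (λ j → t * term B j)   ≈⟨ +-congˡ (Σ-*ˡ (suc n) t (term B)) ⟨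
    det (suc n) A + t * det (suc n) B                ∎
    where
    term-linear : ∀ j → term N j ≈ term A j + t * term B j
    term-linear j with j F.≟ k
    ... | yes refl = begin
      sgn (toℕ j) * (N fzero j * det n (minor N j))
        ≈⟨ *-congˡ (*-cong (Nₖ fzero) (det-cong n (λ r s → N≈A (fsuc r) (punchIn j s) (punchInᵢ≢i j s)))) ⟩
      sgn (toℕ j) * ((A fzero j + t * B fzero j) * det n (minor A j))
        ≈⟨ *-congˡ (≈-trans (*-comm _ _) (scale-combination _ _ _ t)) ⟩
      sgn (toℕ j) * (det n (minor A j) * A fzero j + t * (det n (minor A j) * B fzero j))
        ≈⟨ scale-combination _ _ _ t ⟩
      sgn (toℕ j) * (det n (minor A j) * A fzero j) + t * (sgn (toℕ j) * (det n (minor A j) * B fzero j))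
        ≈⟨ +-cong (*-congˡ (*-comm _ _)) (*-congˡ (*-congˡ (*-cong
             (det-cong n (λ r s → ≈-sym (B≈A (fsuc r) (punchIn j s) (punchInᵢ≢i j s)))) ≈-refl))) ⟩
      term A j + t * (sgn (toℕ j) * (det n (minor B j) * B fzero j))
        ≈⟨ +-congˡ (*-congˡ (*-congˡ (*-comm _ _))) ⟩
      term A j + t * term B j ∎
    ... | no j≢k = begin
      sgn (toℕ j) * (N fzero j * det n (minor N j))
        ≈⟨ *-congˡ (*-cong (N≈A fzero j j≢k) minor-linear) ⟩
      sgn (toℕ j) * (A fzero j * (det n (minor A j) + t * det n (minor B j)))
        ≈⟨ *-congˡ (scale-combination _ _ _ t) ⟩
      sgn (toℕ j) * (A fzero j * det n (minor A j) + t * (A fzero j * det n (minor B j)))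
        ≈⟨ scale-combination _ _ _ t ⟩
      term A j + t * (sgn (toℕ j) * (A fzero j * det n (minor B j)))
        ≈⟨ +-congˡ (*-congˡ (*-congˡ (*-congʳ (≈-sym (B≈A fzero j j≢k))))) ⟩
      term A j + t * term B j ∎
      where
      -- Column k of the full matrix is column punchOut j≢k of the minors.
      k′ : Fin n
      k′ = punchOut j≢k
      off-k′ : ∀ s → s ≢ k′ → punchIn j s ≢ k
      off-k′ s s≢k′ eq = s≢k′ (punchIn-injective j s k′ (Eq.trans eq (Eq.sym (punchIn-punchOut j≢k))))
      at-k′ : ∀ (X : Mat (suc n)) r → X (fsuc r) (punchIn j k′) ≡ X (fsuc r) k
      at-k′ X r = cong (X (fsuc r)) (punchIn-punchOut j≢k)
      minor-linear : det n (minor N j) ≈ det n (minor A j) + t * det n (minor B j)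
      minor-linear = det-linear n k′ (minor A j) (minor B j) (minor N j) t
        (λ r s s≢k′ → N≈A (fsuc r) (punchIn j s) (off-k′ s s≢k′))
        (λ r s s≢k′ → B≈A (fsuc r) (punchIn j s) (off-k′ s s≢k′))
        (λ r → begin
          N (fsuc r) (punchIn j k′)                         ≡⟨ at-k′ N r ⟩
          N (fsuc r) k                                      ≈⟨ Nₖ (fsuc r) ⟩
          A (fsuc r) k + t * B (fsuc r) k                   ≡⟨ Eq.cong₂ (λ u v → u + t * v) (Eq.sym (at-k′ A r)) (Eq.sym (at-k′ B r)) ⟩
          A (fsuc r) (punchIn j k′) + t * B (fsuc r) (punchIn j k′) ∎)

  det-zero-column : ∀ n (M : Mat n) k → (∀ i → M i k ≈ 0#) → det n M ≈ 0#
  det-zero-column n M k Mₖ≈0 = x+x≈x⇒x≈0 _ (begin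
    det n M + det n M       ≈⟨ +-congˡ (*-identityˡ _) ⟨
    det n M + 1# * det n M  ≈⟨ det-linear n k M M M 1# (λ _ _ _ → ≈-refl) (λ _ _ _ → ≈-refl) Mₖ≈Mₖ+Mₖ ⟨
    det n M                 ∎)
    where
    Mₖ≈Mₖ+Mₖ : ∀ i → M i k ≈ M i k + 1# * M i k
    Mₖ≈Mₖ+Mₖ i = begin
      M i k                 ≈⟨ +-identityʳ _ ⟨
      M i k + 0#            ≈⟨ +-congˡ (zeroʳ 1#) ⟨
      M i k + 1# * 0#       ≈⟨ +-congˡ (*-congˡ (Mₖ≈0 i)) ⟨
      M i k + 1# * M i k    ∎

  punchIn-adjacent : ∀ {n} {c d : Fin (suc n)} → toℕ d ≡ suc (toℕ c) → ∀ (s : Fin n) →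
                     punchIn c s ≡ punchIn d s ⊎ (punchIn c s ≡ d × punchIn d s ≡ c)
  punchIn-adjacent {c = fzero} {fsuc fzero} refl fzero = inj₂ (refl , refl)
  punchIn-adjacent {c = fzero} {fsuc fzero} refl (fsuc s) = inj₁ refl
  punchIn-adjacent {c = fzero} {fsuc (fsuc _)} ()
  punchIn-adjacent {c = fsuc c} {fsuc d} d≡c+1 fzero = inj₁ refl
  punchIn-adjacent {c = fsuc c} {fsuc d} d≡c+1 (fsuc s)
    with punchIn-adjacent {c = c} {d} (NP.suc-injective d≡c+1) s
  ... | inj₁ eq = inj₁ (cong fsuc eq)
  ... | inj₂ (eq₁ , eq₂) = inj₂ (cong fsuc eq₁ , cong fsuc eq₂)

  punchOut-adjacent : ∀ {n} {j c d : Fin (suc n)} (j≢c : j ≢ c) (j≢d : j ≢ d) → toℕ d ≡ suc (toℕ c) →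
                      toℕ (punchOut j≢d) ≡ suc (toℕ (punchOut j≢c))
  punchOut-adjacent {j = fzero} {fzero} j≢c j≢d _ = ⊥-elim (j≢c refl)
  punchOut-adjacent {j = fsuc fzero} {fzero} {fsuc fzero} j≢c j≢d refl = ⊥-elim (j≢d refl)
  punchOut-adjacent {suc (suc n)} {j = fsuc (fsuc j)} {fzero} {fsuc fzero} j≢c j≢d refl = refl
  punchOut-adjacent {j = j} {fzero} {fsuc (fsuc _)} j≢c j≢d ()
  punchOut-adjacent {j = j} {fsuc c} {fzero} j≢c j≢d ()
  punchOut-adjacent {j = fzero} {fsuc c} {fsuc d} j≢c j≢d d≡c+1 = NP.suc-injective d≡c+1
  punchOut-adjacent {suc n} {j = fsuc j} {fsuc c} {fsuc d} j≢c j≢d d≡c+1 =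
    cong suc (punchOut-adjacent {n} {j} {c} {d} (j≢c ∘ cong fsuc) (j≢d ∘ cong fsuc) (NP.suc-injective d≡c+1))

  -- A determinant with two equal adjacent columns vanishes. In the first-row expansion the
  -- terms of the two equal columns cancel, and all other minors again have two equal
  -- adjacent columns.
  det-adjacent-equal : ∀ n (M : Mat n) {c d : Fin n} → toℕ d ≡ suc (toℕ c) →
                       (∀ i → M i c ≈ M i d) → det n M ≈ 0#
  det-adjacent-equal (suc n) M {c} {d} d≡c+1 c≈d = Σ-adjacent-pair (suc n) (term M) d≡c+1 pair rest
    where
    same-minor : ∀ r s → minor M d r s ≈ minor M c r s
    same-minor r s with punchIn-adjacent d≡c+1 s
    ... | inj₁ eq = ≡⇒≈ (cong (M (fsuc r)) (Eq.sym eq))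
    ... | inj₂ (eq₁ , eq₂) = begin
      M (fsuc r) (punchIn d s) ≡⟨ cong (M (fsuc r)) eq₂ ⟩
      M (fsuc r) c             ≈⟨ c≈d (fsuc r) ⟩
      M (fsuc r) d             ≡⟨ cong (M (fsuc r)) (Eq.sym eq₁) ⟩
      M (fsuc r) (punchIn c s) ∎
    pair : term M c + term M d ≈ 0#
    pair = begin
      term M c + term M d
        ≈⟨ +-congˡ (*-cong (≡⇒≈ (cong sgn d≡c+1)) (*-cong (≈-sym (c≈d fzero)) (det-cong n same-minor))) ⟩
      term M c + (- sgn (toℕ c)) * (M fzero c * det n (minor M c)) ≈⟨ +-congˡ (-‿distribˡ-* _ _) ⟨
      term M c + - term M c                                          ≈⟨ -‿inverseʳ _ ⟩
      0#                                                             ∎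
    rest : ∀ j → j ≢ c → j ≢ d → term M j ≈ 0#
    rest j j≢c j≢d = ≈-trans (*-congˡ (≈-trans (*-congˡ minor≈0) (zeroʳ _))) (zeroʳ _)
      where
      minor≈0 : det n (minor M j) ≈ 0#
      minor≈0 = det-adjacent-equal n (minor M j) (punchOut-adjacent j≢c j≢d d≡c+1) (λ r → begin
        M (fsuc r) (punchIn j (punchOut j≢c)) ≡⟨ cong (M (fsuc r)) (punchIn-punchOut j≢c) ⟩
        M (fsuc r) c                          ≈⟨ c≈d (fsuc r) ⟩
        M (fsuc r) d                          ≡⟨ cong (M (fsuc r)) (Eq.sym (punchIn-punchOut j≢d)) ⟩
        M (fsuc r) (punchIn j (punchOut j≢d)) ∎)

  det-add-adjacent : ∀ n (M N : Mat n) {k l : Fin n} (t : Carrier) → toℕ l ≡ suc (toℕ k) →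
                     (∀ i j → j ≢ l → N i j ≈ M i j) → (∀ i → N i l ≈ M i l + t * M i k) →
                     det n N ≈ det n M
  det-add-adjacent n M N {k} {l} t l≡k+1 N≈M Nₗ = begin
    det n N              ≈⟨ det-linear n l M B N t N≈M B≈M (λ i → ≈-trans (Nₗ i) (+-congˡ (*-congˡ (≡⇒≈ (Eq.sym (B-at-l i)))))) ⟩
    det n M + t * det n B ≈⟨ +-congˡ (≈-trans (*-congˡ B-singular) (zeroʳ t)) ⟩
    det n M + 0#         ≈⟨ +-identityʳ _ ⟩
    det n M              ∎
    where
    B : Mat n
    B i j with j F.≟ l
    ... | yes _ = M i k
    ... | no _ = M i j
    B-at-l : ∀ i → B i l ≡ M i k
    B-at-l i with l F.≟ l
    ... | yes _ = refl
    ... | no l≢l = ⊥-elim (l≢l refl)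
    B≈M : ∀ i j → j ≢ l → B i j ≈ M i j
    B≈M i j j≢l with j F.≟ l
    ... | yes j≡l = ⊥-elim (j≢l j≡l)
    ... | no _ = ≈-refl
    k≢l : k ≢ l
    k≢l refl = NP.1+n≢n (Eq.sym l≡k+1)
    B-singular : det n B ≈ 0#
    B-singular = det-adjacent-equal n B l≡k+1 (λ i → ≈-trans (B≈M i k k≢l) (≡⇒≈ (Eq.sym (B-at-l i))))

  matrix : (n : ℕ) → (ℕ → ℕ → Carrier) → Mat n
  matrix n e i j = e (toℕ i) (toℕ j)

  -- Columns given by a recurrence: if column 0 of g is that of f and each further column of g
  -- is the corresponding column of f plus t times the previous column of g, then g and f
  -- have the same determinant: g arises from f by adding multiples of adjacent columns.
  det-recurrence : ∀ n (f g : ℕ → ℕ → Carrier) (t : Carrier) →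
                   (∀ i → g i 0 ≈ f i 0) → (∀ i j → g i (suc j) ≈ f i (suc j) + t * g i j) →
                   det n (matrix n g) ≈ det n (matrix n f)
  det-recurrence n f g t g₀≈f₀ g≈f+tg = begin
    det n (matrix n g)         ≈⟨ det-cong n (λ i j → ≡⇒≈ (Eq.sym (mixed-≤ (FP.toℕ≤pred[n] j)))) ⟩
    det n (matrix n (mixed (N.pred n))) ≈⟨ mixed-invariant (N.pred n) ⟩
    det n (matrix n f)         ∎
    where
    -- In mixed u the columns up to u are already those of g, the later ones still those of f.
    mixed : ℕ → ℕ → ℕ → Carrier
    mixed u i j with j N.≤? u
    ... | yes _ = g i j
    ... | no _ = f i j

    mixed-≤ : ∀ {u i j} → j N.≤ u → mixed u i j ≡ g i j
    mixed-≤ {u} {i} {j} j≤u with j N.≤? u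
    ... | yes _ = refl
    ... | no j≰u = ⊥-elim (j≰u j≤u)

    mixed-> : ∀ {u i j} → ¬ j N.≤ u → mixed u i j ≡ f i j
    mixed-> {u} {i} {j} j≰u with j N.≤? u
    ... | yes j≤u = ⊥-elim (j≰u j≤u)
    ... | no _ = refl

    mixed-off : ∀ u i j → j ≢ suc u → mixed (suc u) i j ≡ mixed u i j
    mixed-off u i j j≢u+1 with j N.≤? u
    ... | yes j≤u = mixed-≤ (NP.m≤n⇒m≤1+n j≤u)
    ... | no j≰u = mixed-> (λ j≤u+1 → j≢u+1 (NP.≤-antisym j≤u+1 (NP.≰⇒> j≰u)))

    mixed-new : ∀ u i → mixed (suc u) i (suc u) ≈ mixed u i (suc u) + t * mixed u i u
    mixed-new u i = begin
      mixed (suc u) i (suc u)               ≡⟨ mixed-≤ NP.≤-refl ⟩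
      g i (suc u)                           ≈⟨ g≈f+tg i u ⟩
      f i (suc u) + t * g i u               ≡⟨ Eq.cong₂ (λ a b → a + t * b) (Eq.sym (mixed-> NP.1+n≰n)) (Eq.sym (mixed-≤ NP.≤-refl)) ⟩
      mixed u i (suc u) + t * mixed u i u   ∎

    mixed-0 : ∀ i j → mixed 0 i j ≈ f i j
    mixed-0 i zero = ≈-trans (≡⇒≈ (mixed-≤ {0} N.z≤n)) (g₀≈f₀ i)
    mixed-0 i (suc j) = ≡⇒≈ (mixed-> {0} λ ())

    mixed-invariant : ∀ u → det n (matrix n (mixed u)) ≈ det n (matrix n f)
    mixed-invariant zero = det-cong n (λ i j → mixed-0 (toℕ i) (toℕ j))
    mixed-invariant (suc u) with suc u N.<? n
    ... | no u+1≮n = ≈-trans (det-cong n (λ i j → ≡⇒≈ (mixed-off u (toℕ i) (toℕ j) (j≢u+1 j))))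
                             (mixed-invariant u)
      where
      j≢u+1 : ∀ (j : Fin n) → toℕ j ≢ suc u
      j≢u+1 j j≡u+1 = u+1≮n (Eq.subst (N._< n) j≡u+1 (FP.toℕ<n j))
    ... | yes u+1<n = ≈-trans
          (det-add-adjacent n (matrix n (mixed u)) (matrix n (mixed (suc u))) t l≡k+1
            (λ i j j≢l → ≡⇒≈ (mixed-off u (toℕ i) (toℕ j) (λ j≡u+1 → j≢l (FP.toℕ-injective (Eq.trans j≡u+1 (Eq.sym toℕl))))))
            (λ i → at-l (toℕ i)))
          (mixed-invariant u)
      where
      k l : Fin n
      k = F.fromℕ< (NP.<-trans (NP.n<1+n u) u+1<n)
      l = F.fromℕ< u+1<n
      toℕk : toℕ k ≡ u
      toℕk = FP.toℕ-fromℕ< _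
      toℕl : toℕ l ≡ suc u
      toℕl = FP.toℕ-fromℕ< u+1<n
      l≡k+1 : toℕ l ≡ suc (toℕ k)
      l≡k+1 = Eq.trans toℕl (cong suc (Eq.sym toℕk))
      at-l : ∀ i → mixed (suc u) i (toℕ l) ≈ mixed u i (toℕ l) + t * mixed u i (toℕ k)
      at-l i rewrite toℕl | toℕk = mixed-new u i

  -- Expansion along the first column, by induction: expanding along the first row and then
  -- along the first column of each minor yields the same double sum as the other way round.
  det-first-column : ∀ n (M : Mat (suc n)) →
    det (suc n) M ≈ Σ (suc n) (λ i → sgn (toℕ i) * (M i fzero * det n (λ r s → M (punchIn i r) (fsuc s))))
  det-first-column zero M = ≈-refl
  det-first-column (suc m) M = +-congˡ (begin
      Σ (suc m) (λ j → (- sgn (toℕ j)) * (M fzero (fsuc j) * det (suc m) (minor M (fsuc j))))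
        ≈⟨ Σ-cong (suc m) (λ j → *-congˡ { - sgn (toℕ j)} (*-congˡ {M fzero (fsuc j)} (det-first-column m (minor M (fsuc j))))) ⟩
      Σ (suc m) (λ j → (- sgn (toℕ j)) * (M fzero (fsuc j) * Σ (suc m) (λ i → column-term i j)))
        ≈⟨ Σ-cong (suc m) (λ j → distribute (- sgn (toℕ j)) (M fzero (fsuc j)) (λ i → column-term i j)) ⟩
      Σ (suc m) (λ j → Σ (suc m) (λ i → (- sgn (toℕ j)) * (M fzero (fsuc j) * column-term i j)))
        ≈⟨ Σ-comm (suc m) (suc m) (λ j i → (- sgn (toℕ j)) * (M fzero (fsuc j) * column-term i j)) ⟩
      Σ (suc m) (λ i → Σ (suc m) (λ j → (- sgn (toℕ j)) * (M fzero (fsuc j) * column-term i j)))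
        ≈⟨ Σ-cong (suc m) (λ i → Σ-cong (suc m) (λ j → swap-factors (sgn (toℕ j)) (M fzero (fsuc j)) (sgn (toℕ i)) (M (fsuc i) fzero) (G i j))) ⟩
      Σ (suc m) (λ i → Σ (suc m) (λ j → (- sgn (toℕ i)) * (M (fsuc i) fzero * row-term i j)))
        ≈⟨ Σ-cong (suc m) (λ i → distribute (- sgn (toℕ i)) (M (fsuc i) fzero) (row-term i)) ⟨
      Σ (suc m) (λ i → (- sgn (toℕ i)) * (M (fsuc i) fzero * Σ (suc m) (row-term i))) ∎)
    where
    G : Fin (suc m) → Fin (suc m) → Carrier
    G i j = det m (λ r s → M (fsuc (punchIn i r)) (fsuc (punchIn j s)))
    column-term row-term : Fin (suc m) → Fin (suc m) → Carrier
    column-term i j = sgn (toℕ i) * (M (fsuc i) fzero * G i j)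
    row-term i j = sgn (toℕ j) * (M fzero (fsuc j) * G i j)
    distribute : ∀ a b (f : Fin (suc m) → Carrier) → a * (b * Σ (suc m) f) ≈ Σ (suc m) (λ i → a * (b * f i))
    distribute a b f = ≈-trans (*-congˡ (Σ-*ˡ (suc m) b f)) (Σ-*ˡ (suc m) a (λ i → b * f i))
    swap-factors : ∀ x y z w g → (- x) * (y * (z * (w * g))) ≈ (- z) * (w * (x * (y * g)))
    swap-factors x y z w g = begin
      (- x) * (y * (z * (w * g))) ≈⟨ -‿distribˡ-* _ _ ⟨
      - (x * (y * (z * (w * g)))) ≈⟨ -‿cong (*-solve 5 (λ x y z w g → x ⊛ (y ⊛ (z ⊛ (w ⊛ g))) ⊜* z ⊛ (w ⊛ (x ⊛ (y ⊛ g)))) ≈-refl x y z w g) ⟩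
      - (z * (w * (x * (y * g)))) ≈⟨ -‿distribˡ-* _ _ ⟩
      (- z) * (w * (x * (y * g))) ∎

  det-transpose : ∀ n (M : Mat n) → det n (λ i j → M j i) ≈ det n M
  det-transpose zero M = ≈-refl
  det-transpose (suc n) M = ≈-trans
    (Σ-cong (suc n) (λ j → *-congˡ {sgn (toℕ j)} (*-congˡ {M j fzero} (det-transpose n (λ r s → M (punchIn j r) (fsuc s))))))
    (≈-sym (det-first-column n M))

  det-partial-sums : ∀ n (e : ℕ → ℕ → Carrier) →
                     det n (matrix n (λ i j → Σ< (suc j) (e i))) ≈ det n (matrix n e)
  det-partial-sums n e = det-recurrence n e (λ i j → Σ< (suc j) (e i)) 1# (λ i → +-identityʳ _) step
    where
    step : ∀ i j → Σ< (suc (suc j)) (e i) ≈ e i (suc j) + 1# * Σ< (suc j) (e i)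
    step i j = begin
      Σ< (suc (suc j)) (e i)              ≈⟨ Σ<-last (suc j) (e i) ⟩
      Σ< (suc j) (e i) + e i (suc j)      ≈⟨ +-comm _ _ ⟩
      e i (suc j) + Σ< (suc j) (e i)      ≈⟨ +-congˡ (*-identityˡ _) ⟨
      e i (suc j) + 1# * Σ< (suc j) (e i) ∎

  toℕ-punchIn-last : ∀ n (s : Fin n) → toℕ (punchIn (F.fromℕ n) s) ≡ toℕ s
  toℕ-punchIn-last (suc n) fzero = refl
  toℕ-punchIn-last (suc n) (fsuc s) = cong suc (toℕ-punchIn-last n s)

  det-last-column : ∀ n (e : ℕ → ℕ → Carrier) → (∀ r → e (suc r) n ≈ 0#) →
    det (suc n) (matrix (suc n) e) ≈ sgn n * (e 0 n * det n (matrix n (λ r s → e (suc r) s)))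
  det-last-column n e last≈0 = begin
    Σ (suc n) (term (matrix (suc n) e))   ≈⟨ Σ-single (suc n) _ last other-term ⟩
    term (matrix (suc n) e) last          ≡⟨ Eq.cong₂ (λ u v → sgn u * (e 0 v * det n (minor (matrix (suc n) e) last))) (FP.toℕ-fromℕ n) (FP.toℕ-fromℕ n) ⟩
    sgn n * (e 0 n * det n (minor (matrix (suc n) e) last))
      ≈⟨ *-congˡ (*-congˡ (det-cong n (λ r s → ≡⇒≈ (cong (e (suc (toℕ r))) (toℕ-punchIn-last n s))))) ⟩
    sgn n * (e 0 n * det n (matrix n (λ r s → e (suc r) s))) ∎
    where
    last : Fin (suc n)
    last = F.fromℕ n
    -- Every other minor contains the vanishing part of the last column.
    other-term : ∀ j → j ≢ last → term (matrix (suc n) e) j ≈ 0#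
    other-term j j≢last = ≈-trans (*-congˡ (≈-trans (*-congˡ minor≈0) (zeroʳ _))) (zeroʳ _)
      where
      minor≈0 : det n (minor (matrix (suc n) e) j) ≈ 0#
      minor≈0 = det-zero-column n _ (punchOut j≢last) (λ r → begin
        e (suc (toℕ r)) (toℕ (punchIn j (punchOut j≢last))) ≡⟨ cong (λ k → e (suc (toℕ r)) (toℕ k)) (punchIn-punchOut j≢last) ⟩
        e (suc (toℕ r)) (toℕ last)                          ≡⟨ cong (e (suc (toℕ r))) (FP.toℕ-fromℕ n) ⟩
        e (suc (toℕ r)) n                                   ≈⟨ last≈0 (toℕ r) ⟩
        0#                                                  ∎)

module Hankel {c ℓ} (R : CommutativeRing c ℓ) (q : ℕ) (isPrime : Prime (suc q)) (P≢2 : suc q ≢ 2)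
              (x : CommutativeRing.Carrier R) where
  open CommutativeRing R renaming (refl to ≈-refl; sym to ≈-sym; trans to ≈-trans)
  open RingDefs R
  open Determinants R
  open NatSum using (sumℕ)
  open Residues q
  open Counting isPrime P≢2
  open import Relation.Binary.Reasoning.Setoid setoid
  open import Algebra.Properties.Ring ring using (-0#≈0#)

  χ : ℕ → Carrier
  χ r = ι (legendre P r)

  χ-split : ∀ r → χ r ≈ fromℕ (QR r) + - fromℕ (NR r)
  χ-split r with legendre P r | symbol r
  ... | _ | divisible _ = ≈-sym (≈-trans (+-congˡ -0#≈0#) (+-identityʳ 0#))
  ... | _ | residue _ _ _ = ≈-sym (≈-trans (+-congˡ -0#≈0#) (+-identityʳ _))
  ... | _ | nonresidue _ _ = ≈-sym (+-identityˡ _)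

  -- Σ_{r < P} (r / P) = 0, as there are as many residues as nonresidues.
  χ-period-sum : Σ< P χ ≈ 0#
  χ-period-sum = begin
    Σ< P χ                                                ≈⟨ Σ-cong P (λ r → χ-split (toℕ r)) ⟩
    Σ< P (λ r → fromℕ (QR r) + - fromℕ (NR r))            ≈⟨ Σ-+ P (λ r → fromℕ (QR (toℕ r))) (λ r → - fromℕ (NR (toℕ r))) ⟩
    Σ< P (λ r → fromℕ (QR r)) + Σ< P (λ r → - fromℕ (NR r)) ≈⟨ +-congˡ (Σ-neg P (λ r → fromℕ (NR (toℕ r)))) ⟩
    Σ< P (λ r → fromℕ (QR r)) + - Σ< P (λ r → fromℕ (NR r)) ≈⟨ +-cong (Σ<-fromℕ P QR) (-‿cong (Σ<-fromℕ P NR)) ⟩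
    fromℕ (sumℕ P QR) + - fromℕ (sumℕ P NR)               ≡⟨ cong (λ n → fromℕ (sumℕ P QR) + - fromℕ n) nonresidues≡residues ⟩
    fromℕ (sumℕ P QR) + - fromℕ (sumℕ P QR)               ≈⟨ -‿inverseʳ _ ⟩
    0#                                                    ∎

  χ-window-sum : ∀ m → Σ< P (λ k → χ (k N.+ m)) ≈ 0#
  χ-window-sum m = ≈-trans (Σ<-periodic P χ (λ r → ≡⇒≈ (cong ι (legendre-periodic r))) m) χ-period-sum

  a-recurrence : ∀ m → a P (suc m) x ≈ χ (suc m) + x * a P m x
  a-recurrence m = begin
    χ (suc m) * 1# + Σ (suc m) (λ i → ι (legendre P (m N.∸ toℕ i)) * (x * pow x (toℕ i)))
      ≈⟨ +-cong (*-identityʳ _) (Σ-cong (suc m) (λ i → *-lcomm (ι (legendre P (m N.∸ toℕ i))) x (pow x (toℕ i)))) ⟩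
    χ (suc m) + Σ (suc m) (λ i → x * (ι (legendre P (m N.∸ toℕ i)) * pow x (toℕ i)))
      ≈⟨ +-congˡ (Σ-*ˡ (suc m) x (λ i → ι (legendre P (m N.∸ toℕ i)) * pow x (toℕ i))) ⟨
    χ (suc m) + x * a P m x ∎

  hankel : ℕ → ℕ → Carrier
  hankel i j = a P ((i N.+ j) N.+ 1) x

  reduced : ℕ → ℕ → Carrier
  reduced i zero = hankel i 0
  reduced i (suc j) = χ ((i N.+ suc j) N.+ 1)

  hankel-recurrence : ∀ i j → hankel i (suc j) ≈ reduced i (suc j) + x * hankel i j
  hankel-recurrence i j = begin
    a P ((i N.+ suc j) N.+ 1) x              ≡⟨ cong (λ n → a P n x) index ⟩
    a P (suc ((i N.+ j) N.+ 1)) x            ≈⟨ a-recurrence _ ⟩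
    χ (suc ((i N.+ j) N.+ 1)) + x * hankel i j ≡⟨ cong (λ n → χ n + x * hankel i j) (Eq.sym index) ⟩
    reduced i (suc j) + x * hankel i j       ∎
    where
    index : (i N.+ suc j) N.+ 1 ≡ suc ((i N.+ j) N.+ 1)
    index = cong (N._+ 1) (NP.+-suc i j)

  -- Rows of the transposed reduced matrix below the first one are windows of χ.
  reduced-row-sum : ∀ r → Σ< P (λ k → reduced k (suc r)) ≈ 0#
  reduced-row-sum r = ≈-trans (Σ-cong P (λ k → ≡⇒≈ (cong χ (NP.+-assoc (toℕ k) (suc r) 1)))) (χ-window-sum (suc r N.+ 1))

  reduced-minor : det q (matrix q (λ r k → reduced k (suc r))) ≈ detC P
  reduced-minor = det-cong q (λ r k → ≡⇒≈ (cong χ (index (toℕ r) (toℕ k))))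
    where
    index : ∀ r k → (k N.+ suc r) N.+ 1 ≡ (r N.+ k) N.+ 2
    index r k = Eq.trans (cong (N._+ 1) (Eq.trans (NP.+-suc k r) (cong suc (NP.+-comm k r))))
                         (Eq.sym (NP.+-suc (r N.+ k) 1))

  -- P - 1 = q is even, being twice the number of quadratic residues.
  sgn-q : sgn q ≈ 1#
  sgn-q = ≈-trans (≡⇒≈ (cong sgn (Eq.sym twice-residues))) (sgn-double (sumℕ P QR))

  hankel-determinant : H P x ≈ detC P * Σ P (λ j → a P (toℕ j N.+ 1) x)
  hankel-determinant = begin
    det P (matrix P hankel)                                   ≈⟨ det-recurrence P reduced hankel x (λ _ → ≈-refl) hankel-recurrence ⟩
    det P (matrix P reduced)                                  ≈⟨ det-transpose P (matrix P reduced) ⟨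
    det P (matrix P (λ i j → reduced j i))                    ≈⟨ det-partial-sums P (λ i j → reduced j i) ⟨
    det P (matrix P partial)                                  ≈⟨ det-last-column q partial reduced-row-sum ⟩
    sgn q * (partial 0 q * det q (matrix q (λ r s → partial (suc r) s)))
      ≈⟨ *-cong sgn-q (*-cong first-row (≈-trans (det-partial-sums q (λ r k → reduced k (suc r))) reduced-minor)) ⟩
    1# * (Σ P (λ j → a P (toℕ j N.+ 1) x) * detC P)           ≈⟨ *-identityˡ _ ⟩
    Σ P (λ j → a P (toℕ j N.+ 1) x) * detC P                  ≈⟨ *-comm _ _ ⟩
    detC P * Σ P (λ j → a P (toℕ j N.+ 1) x)                  ∎
    where
    partial : ℕ → ℕ → Carrier
    partial i j = Σ< (suc j) (λ k → reduced k i)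
    first-row : partial 0 q ≈ Σ P (λ j → a P (toℕ j N.+ 1) x)
    first-row = Σ-cong P (λ k → ≡⇒≈ (cong (λ n → a P (n N.+ 1) x) (NP.+-identityʳ (toℕ k))))

open import Data.Nat using (_+_)

lemma4 : ∀ {c ℓ} (R : CommutativeRing c ℓ) (p : ℕ) → Prime p → p ≢ 2 →
    (x : CommutativeRing.Carrier R) →
    CommutativeRing._≈_ R (RingDefs.H R p x)
      (CommutativeRing._*_ R (RingDefs.detC R p)
        (RingDefs.Σ R p (λ j → RingDefs.a R p (toℕ j + 1) x)))
lemma4 R zero isPrime _ x = ⊥-elim (¬prime[0] isPrime)
lemma4 R (suc q) isPrime P≢2 x = Hankel.hankel-determinant R q isPrime P≢2 x
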